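{- Let $G$ be a finite simple graph on $n$ vertices. If $G$ contains a perfect matching $M$ such that for each edge $uv\in M$, $u$ and $v$ are adjacent twins, then $r_2(G)=n$ and $b_2(G)\leq n/2+1$.
   Context: Two vertices $u,v$ are adjacent twins if $N[u]=N[v]$, where $N[x]$ is the closed neighborhood of $x$. $r_2(G)$ denotes the rank over $\mathbb{F}_2$ of the adjacency matrix of $G$. For a finite simple graph $G=(V,E)$, a biclique on a subset of $V$ is given by two disjoint sets $X,Y\subseteq V$; its edges are all pairs $\{x,y\}$ with $x\in X$, $y\in Y$. An odd cover of $G$ is a collection of bicliques on subsets of $V$ such that every pair of vertices adjacent in $G$ is an edge of an odd number of the bicliques, and every pair of distinct non-adjacent vertices is an edge of an even number of the bicliques. $b_2(G)$ denotes the minimum cardinality of an odd cover of $G$. -}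

module Defs where

open import Data.Nat using (ℕ; zero; suc; _≤_)
open import Data.Fin using (Fin; zero; suc)
open import Data.Bool using (Bool; true; false; _∧_; _∨_; _xor_; not)
open import Data.List using (List; length; foldr)
open import Data.Product using (Σ; _×_; ∃; _,_)
open import Data.Empty using (⊥)
open import Relation.Nullary using (¬_)
open import Relation.Binary.PropositionalEquality using (_≡_)
open import Data.Fin using (_≟_)
open import Relation.Nullary.Decidable using (⌊_⌋)

record Graph (n : ℕ) : Set where
  field
    adj   : Fin n → Fin n → Bool
    sym   : ∀ u v → adj u v ≡ adj v u
    irrefl : ∀ u → adj u u ≡ false
open Graph public

-- Arithmetic over F₂ = Bool (addition is xor, multiplication is ∧)

sum₂ : {k : ℕ} → (Fin k → Bool) → Bool
sum₂ {zero}  f = false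
sum₂ {suc k} f = f zero xor sum₂ (λ i → f (suc i))

LinIndep : {k n : ℕ} → (Fin k → Fin n → Bool) → Set
LinIndep {k} {n} v =
  (c : Fin k → Bool) →
  (∀ j → sum₂ (λ i → c i ∧ v i j) ≡ false) →
  ∀ i → c i ≡ false

IsRank₂ : {m n : ℕ} → (Fin m → Fin n → Bool) → ℕ → Set
IsRank₂ {m} {n} A r =
  (Σ (Fin r → Fin m) λ ι → LinIndep (λ i → A (ι i)))
  × ((ι : Fin (suc r) → Fin m) → ¬ LinIndep (λ i → A (ι i)))

r₂≡ : {n : ℕ} → Graph n → ℕ → Set
r₂≡ G r = IsRank₂ (adj G) r

closedN : {n : ℕ} → Graph n → Fin n → Fin n → Bool
closedN G u w = ⌊ w ≟ u ⌋ ∨ adj G u w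

AdjTwins : {n : ℕ} → Graph n → Fin n → Fin n → Set
AdjTwins G u v = ∀ w → closedN G u w ≡ closedN G v w

-- Perfect matchings, represented by the partner map:
-- a fixed-point-free involution m with every uv = u (m u) an edge of G.
record PerfectMatching {n : ℕ} (G : Graph n) : Set where
  field
    partner    : Fin n → Fin n
    invol      : ∀ u → partner (partner u) ≡ u
    noFix      : ∀ u → ¬ (partner u ≡ u)
    isEdge     : ∀ u → adj G u (partner u) ≡ true
open PerfectMatching public

record Biclique (n : ℕ) : Set where
  field
    X Y      : Fin n → Bool
    disjoint : ∀ v → X v ∧ Y v ≡ false
open Biclique public

bicEdge : {n : ℕ} → Biclique n → Fin n → Fin n → Bool
bicEdge B u v = (X B u ∧ Y B v) ∨ (X B v ∧ Y B u)

parity : {n : ℕ} → List (Biclique n) → Fin n → Fin n → Bool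
parity Bs u v = foldr (λ B acc → bicEdge B u v xor acc) false Bs

IsOddCover : {n : ℕ} → Graph n → List (Biclique n) → Set
IsOddCover G Bs = ∀ u v → ¬ (u ≡ v) → parity Bs u v ≡ adj G u v

b₂≤ : {n : ℕ} → Graph n → ℕ → Set
b₂≤ G k = Σ (List (Biclique _)) λ Bs → IsOddCover G Bs × length Bs ≤ k

-- Let p be the partner map and P its permutation matrix.  Since N[u] = N[p u], rows u and
-- p u of the adjacency matrix A differ exactly in the columns u and p u: (I + P) A = I + P
-- over F₂.  If c A = 0 then, A being symmetric, c = c P; such a c equals d (I + P) for d its
-- restriction to one endpoint of each matching edge, so c A = c and hence c = 0.
--
-- For the odd cover fix a set H containing exactly one endpoint of each matching edge.  The
-- biclique (H, V ∖ H) covers the matching edges, but also every pair split by H.  For a ∈ H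
-- take the biclique with sides {a, p a} and the outside vertices w that are adjacent to a with
-- the edge of a preceding that of w, toggled by membership of w in H.  Twins have the same
-- outside neighbours, so every edge between two matching edges is covered exactly once, and
-- the toggles cancel the split pairs.  This uses |H| + 1 = n/2 + 1 bicliques.

module Submission where

open import Defs renaming (sym to adj-sym)
open import Data.Nat using (ℕ; zero; suc; _+_; _*_; _/_; _≤_; _<?_; _⊓_)
import Data.Nat.Properties as ℕ
open import Data.Nat.DivMod using (m*n/n≡m)
open import Data.Fin using (Fin; zero; suc; toℕ; _≟_)
open import Data.Fin.Properties using (toℕ-injective; pigeonhole; <-irrefl)
open import Data.Fin.Permutation using (Permutation; permutation; _⟨$⟩ʳ_)
open import Data.Bool using (Bool; true; false; _∧_; _∨_; _xor_; not; if_then_else_)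
open import Data.Bool.Properties
  using ( xor-∧-commutativeRing; xor-comm; xor-assoc; xor-same; xor-identityʳ
        ; ∧-comm; ∧-assoc; ∧-identityʳ; ∧-zeroʳ; ∧-inverseʳ; ∧-distribˡ-xor; ∧-distribʳ-xor)
open import Data.List using (List; []; _∷_; length)
open import Data.Product using (_×_; _,_)
open import Data.Sum using (_⊎_; inj₁; inj₂)
open import Data.Empty using (⊥)
open import Function using (_∘_; id)
open import Algebra.Bundles using (CommutativeRing; CommutativeMonoid)
import Algebra.Properties.CommutativeMonoid.Sum as CommutativeMonoidSum
import Algebra.Properties.CommutativeSemigroup as CommutativeSemigroupProperties
open import Relation.Binary.PropositionalEquality
open import Relation.Binary.Definitions using (tri<; tri≈; tri>)
open import Relation.Nullary using (¬_; Dec; yes; no; contradiction)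
open import Relation.Nullary.Decidable using (⌊_⌋; isYes≗does; dec-true; dec-false; ⌊⌋-map′)

⊕-commutativeMonoid : CommutativeMonoid _ _
⊕-commutativeMonoid = CommutativeRing.+-commutativeMonoid xor-∧-commutativeRing

open CommutativeSemigroupProperties (CommutativeMonoid.commutativeSemigroup ⊕-commutativeMonoid)
  using (interchange)

xor≡false⇒≡ : ∀ {x y} → x xor y ≡ false → x ≡ y
xor≡false⇒≡ {false} {false} _ = refl
xor≡false⇒≡ {true}  {true}  _ = refl

∨≡xor : ∀ x y → x ∧ y ≡ false → x ∨ y ≡ x xor y
∨≡xor false y _    = refl
∨≡xor true  y refl = refl

∧-not-xor : ∀ x y → (x ∧ not y) xor (y ∧ not x) ≡ x xor y
∧-not-xor false false = refl
∧-not-xor false true  = refl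
∧-not-xor true  false = refl
∧-not-xor true  true  = refl

∧-not-∧-zero : ∀ x y → x ∧ (not x ∧ y) ≡ false
∧-not-∧-zero x y = trans (sym (∧-assoc x (not x) y)) (cong (_∧ y) (∧-inverseʳ x))

xor-cancelˡ : ∀ z a → z xor (a xor z) ≡ a
xor-cancelˡ z a = begin
  z xor (a xor z)  ≡⟨ cong (z xor_) (xor-comm a z) ⟩
  z xor (z xor a)  ≡⟨ xor-assoc z z a ⟨
  (z xor z) xor a  ≡⟨ cong (_xor a) (xor-same z) ⟩
  a                ∎
  where open ≡-Reasoning

⌊⌋-true : ∀ {A : Set} (a? : Dec A) → A → ⌊ a? ⌋ ≡ true
⌊⌋-true a? a = trans (isYes≗does a?) (dec-true a? a)

⌊⌋-false : ∀ {A : Set} (a? : Dec A) → ¬ A → ⌊ a? ⌋ ≡ false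
⌊⌋-false a? ¬a = trans (isYes≗does a?) (dec-false a? ¬a)

xor-orientation : ∀ x y a k k′ → k xor k′ ≡ true →
                  (x xor y) xor (((k ∧ a) xor y) xor ((k′ ∧ a) xor x)) ≡ a
xor-orientation x y a k k′ k⊕k′ = begin
  (x xor y) xor (((k ∧ a) xor y) xor ((k′ ∧ a) xor x))
    ≡⟨ cong ((x xor y) xor_) (interchange (k ∧ a) y (k′ ∧ a) x) ⟩
  (x xor y) xor (((k ∧ a) xor (k′ ∧ a)) xor (y xor x))
    ≡⟨ cong (λ b → (x xor y) xor (b xor (y xor x))) (∧-distribʳ-xor a k k′) ⟨
  (x xor y) xor (((k xor k′) ∧ a) xor (y xor x))
    ≡⟨ cong₂ (λ b c → (x xor y) xor ((b ∧ a) xor c)) k⊕k′ (xor-comm y x) ⟩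
  (x xor y) xor (a xor (x xor y))
    ≡⟨ xor-cancelˡ (x xor y) a ⟩
  a ∎
  where open ≡-Reasoning

<?-xor-swap : ∀ {a b} → a ≢ b → ⌊ a <? b ⌋ xor ⌊ b <? a ⌋ ≡ true
<?-xor-swap {a} {b} a≢b with ℕ.<-cmp a b
... | tri< a<b _ b≮a = cong₂ _xor_ (⌊⌋-true (a <? b) a<b) (⌊⌋-false (b <? a) b≮a)
... | tri≈ _ a≡b _   = contradiction a≡b a≢b
... | tri> a≮b _ b<a = cong₂ _xor_ (⌊⌋-false (a <? b) a≮b) (⌊⌋-true (b <? a) b<a)

module ⊕Sum = CommutativeMonoidSum ⊕-commutativeMonoid
module ℕSum = CommutativeMonoidSum ℕ.+-0-commutativeMonoid

sum₂≗sum : ∀ {k} (f : Fin k → Bool) → sum₂ f ≡ ⊕Sum.sum f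
sum₂≗sum {zero}  f = refl
sum₂≗sum {suc k} f = cong (f zero xor_) (sum₂≗sum (f ∘ suc))

sum₂-cong : ∀ {k} {f g : Fin k → Bool} → (∀ i → f i ≡ g i) → sum₂ f ≡ sum₂ g
sum₂-cong {f = f} {g} f≗g =
  trans (sum₂≗sum f) (trans (⊕Sum.sum-cong-≗ f≗g) (sym (sum₂≗sum g)))

sum₂-xor : ∀ {k} (f g : Fin k → Bool) → sum₂ (λ i → f i xor g i) ≡ sum₂ f xor sum₂ g
sum₂-xor f g = trans (sum₂≗sum (λ i → f i xor g i))
  (trans (⊕Sum.∑-distrib-+ f g) (sym (cong₂ _xor_ (sum₂≗sum f) (sum₂≗sum g))))

sum₂-permute : ∀ {k} (f : Fin k → Bool) (π : Permutation k k) → sum₂ (f ∘ (π ⟨$⟩ʳ_)) ≡ sum₂ f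
sum₂-permute f π = trans (sum₂≗sum (f ∘ (π ⟨$⟩ʳ_))) (trans (sym (⊕Sum.sum-permute f π)) (sym (sum₂≗sum f)))

sum₂-false : ∀ k → sum₂ {k} (λ _ → false) ≡ false
sum₂-false zero    = refl
sum₂-false (suc k) = sum₂-false k

δ : ∀ {k} → Fin k → Fin k → Bool
δ i j = ⌊ i ≟ j ⌋

δ-refl : ∀ {k} (i : Fin k) → δ i i ≡ true
δ-refl i = ⌊⌋-true (i ≟ i) refl

δ-≢ : ∀ {k} {i j : Fin k} → i ≢ j → δ i j ≡ false
δ-≢ {i = i} {j} = ⌊⌋-false (i ≟ j)

δ-sym : ∀ {k} (i j : Fin k) → δ i j ≡ δ j i
δ-sym i j with i ≟ j
... | yes refl = sym (δ-refl i)
... | no i≢j   = sym (δ-≢ (i≢j ∘ sym))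

sum₂-sift : ∀ {k} (f : Fin k → Bool) (j : Fin k) → sum₂ (λ i → f i ∧ δ i j) ≡ f j
sum₂-sift {suc k} f zero = begin
  (f zero ∧ true) xor sum₂ (λ i → f (suc i) ∧ false)
    ≡⟨ cong₂ _xor_ (∧-identityʳ (f zero)) (sum₂-cong {k} (λ i → ∧-zeroʳ (f (suc i)))) ⟩
  f zero xor sum₂ {k} (λ _ → false)
    ≡⟨ cong (f zero xor_) (sum₂-false k) ⟩
  f zero xor false
    ≡⟨ xor-identityʳ (f zero) ⟩
  f zero ∎
  where open ≡-Reasoning
sum₂-sift f (suc j) rewrite ∧-zeroʳ (f zero) =
  trans (sum₂-cong λ i → cong (f (suc i) ∧_) (⌊⌋-map′ _ _ (i ≟ j))) (sum₂-sift (f ∘ suc) j)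

indicator : ∀ {k} → (Fin k → Bool) → Fin k → ℕ
indicator s i = if s i then 1 else 0

count : ∀ {k} → (Fin k → Bool) → ℕ
count s = ℕSum.sum (indicator s)

count-const-true : ∀ k → count {k} (λ _ → true) ≡ k
count-const-true zero    = refl
count-const-true (suc k) = cong suc (count-const-true k)

¬LinIndep-repeated : ∀ {m k} (v : Fin m → Fin k → Bool) {i j : Fin m} →
                     i ≢ j → v i ≡ v j → ¬ LinIndep v
¬LinIndep-repeated v {i} {j} i≢j vi≡vj indep =
  contradiction (trans (sym c-at-i) (indep c c-vanishes i)) λ ()
  where
  c : _ → Bool
  c l = δ l i xor δ l j

  c-at-i : c i ≡ true
  c-at-i = cong₂ _xor_ (δ-refl i) (δ-≢ i≢j)

  c-vanishes : ∀ col → sum₂ (λ l → c l ∧ v l col) ≡ false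
  c-vanishes col = begin
    sum₂ (λ l → c l ∧ v l col)
      ≡⟨ sum₂-cong (λ l → trans (∧-comm (c l) _) (∧-distribˡ-xor (v l col) _ _)) ⟩
    sum₂ (λ l → (v l col ∧ δ l i) xor (v l col ∧ δ l j))
      ≡⟨ sum₂-xor (λ l → v l col ∧ δ l i) (λ l → v l col ∧ δ l j) ⟩
    sum₂ (λ l → v l col ∧ δ l i) xor sum₂ (λ l → v l col ∧ δ l j)
      ≡⟨ cong₂ _xor_ (sum₂-sift (λ l → v l col) i) (sum₂-sift (λ l → v l col) j) ⟩
    v i col xor v j col
      ≡⟨ cong (λ r → v i col xor r col) (sym vi≡vj) ⟩
    v i col xor v i col
      ≡⟨ xor-same (v i col) ⟩
    false ∎
    where open ≡-Reasoning

LinIndep⇒IsRank₂ : ∀ {m k} (A : Fin m → Fin k → Bool) → LinIndep A → IsRank₂ A m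
LinIndep⇒IsRank₂ {m} A indep = (id , indep) , more-rows-dependent
  where
  more-rows-dependent : (ι : Fin (suc m) → Fin m) → ¬ LinIndep (A ∘ ι)
  more-rows-dependent ι with pigeonhole (ℕ.n<1+n m) ι
  ... | i , j , i<j , ιi≡ιj =
    ¬LinIndep-repeated (A ∘ ι) (λ i≡j → <-irrefl i≡j i<j) (cong A ιi≡ιj)

∧-cross-disjoint : ∀ a b c d → a ∧ d ≡ false → (a ∧ b) ∧ (c ∧ d) ≡ false
∧-cross-disjoint false b c d _    = refl
∧-cross-disjoint true  b c d refl rewrite ∧-zeroʳ c = ∧-zeroʳ b

bicEdge≡xor : ∀ {n} (B : Biclique n) u v →
              bicEdge B u v ≡ (X B u ∧ Y B v) xor (X B v ∧ Y B u)
bicEdge≡xor B u v = ∨≡xor (X B u ∧ Y B v) (X B v ∧ Y B u)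
  (∧-cross-disjoint (X B u) (Y B v) (X B v) (Y B u) (disjoint B u))

select : ∀ {A : Set} {k} → (Fin k → Bool) → (Fin k → A) → List A
select {k = zero}  s F = []
select {k = suc k} s F with s zero
... | true  = F zero ∷ select (s ∘ suc) (F ∘ suc)
... | false = select (s ∘ suc) (F ∘ suc)

length-select : ∀ {A : Set} {k} (s : Fin k → Bool) (F : Fin k → A) →
                length (select s F) ≡ count s
length-select {k = zero}  s F = refl
length-select {k = suc k} s F with s zero
... | true  = cong suc (length-select (s ∘ suc) (F ∘ suc))
... | false = length-select (s ∘ suc) (F ∘ suc)

parity-select : ∀ {n k} (s : Fin k → Bool) (F : Fin k → Biclique n) u v →
                parity (select s F) u v ≡ sum₂ (λ a → s a ∧ bicEdge (F a) u v)
parity-select {k = zero}  s F u v = refl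
parity-select {k = suc k} s F u v with s zero
... | true  = cong (bicEdge (F zero) u v xor_) (parity-select (s ∘ suc) (F ∘ suc) u v)
... | false = parity-select (s ∘ suc) (F ∘ suc) u v

module Pairing {n} (p : Fin n → Fin n) (p-invol : ∀ u → p (p u) ≡ u)
                   (p-noFix : ∀ u → p u ≢ u) where

  p-permutation : Permutation n n
  p-permutation = permutation p p p-invol p-invol

  δ-partner : ∀ u w → δ w (p u) ≡ δ u (p w)
  δ-partner u w with w ≟ p u
  ... | yes refl = sym (trans (cong (δ u) (p-invol u)) (δ-refl u))
  ... | no w≢pu  = sym (δ-≢ λ u≡pw → w≢pu (trans (sym (p-invol w)) (cong p (sym u≡pw))))

  -- xor rather than ∨ (the cases are exclusive), so that sums against onEdge split into two sifts
  onEdge : Fin n → Fin n → Bool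
  onEdge u w = δ w u xor δ w (p u)

  onEdge-sym : ∀ u w → onEdge u w ≡ onEdge w u
  onEdge-sym u w = cong₂ _xor_ (δ-sym w u) (δ-partner u w)

  onEdge-partner : ∀ u w → onEdge (p u) w ≡ onEdge u w
  onEdge-partner u w rewrite p-invol u = xor-comm (δ w (p u)) (δ w u)

  onEdge-self : ∀ u → onEdge u u ≡ true
  onEdge-self u = cong₂ _xor_ (δ-refl u) (δ-≢ λ u≡pu → p-noFix u (sym u≡pu))

  onEdge-partnerʳ : ∀ u → onEdge u (p u) ≡ true
  onEdge-partnerʳ u = trans (onEdge-sym u (p u)) (trans (onEdge-partner u u) (onEdge-self u))

  onEdge-off : ∀ {u w} → w ≢ u → w ≢ p u → onEdge u w ≡ false
  onEdge-off w≢u w≢pu = cong₂ _xor_ (δ-≢ w≢u) (δ-≢ w≢pu)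

  sum₂-∧-onEdge : ∀ (f : Fin n → Bool) w → sum₂ (λ i → f i ∧ onEdge i w) ≡ f w xor f (p w)
  sum₂-∧-onEdge f w = begin
    sum₂ (λ i → f i ∧ onEdge i w)
      ≡⟨ sum₂-cong (λ i → trans (cong (f i ∧_) (onEdge-sym i w)) (∧-distribˡ-xor (f i) _ _)) ⟩
    sum₂ (λ i → (f i ∧ δ i w) xor (f i ∧ δ i (p w)))
      ≡⟨ sum₂-xor (λ i → f i ∧ δ i w) (λ i → f i ∧ δ i (p w)) ⟩
    sum₂ (λ i → f i ∧ δ i w) xor sum₂ (λ i → f i ∧ δ i (p w))
      ≡⟨ cong₂ _xor_ (sum₂-sift f w) (sum₂-sift f (p w)) ⟩
    f w xor f (p w) ∎
    where open ≡-Reasoning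

  half : Fin n → Bool
  half i = ⌊ toℕ i <? toℕ (p i) ⌋

  half-xor : ∀ i → half i xor half (p i) ≡ true
  half-xor i = subst (λ j → half i xor ⌊ toℕ (p i) <? toℕ j ⌋ ≡ true) (sym (p-invol i))
    (<?-xor-swap λ i≡pi → p-noFix i (sym (toℕ-injective i≡pi)))

  sum₂-pair : ∀ (f : Fin n → Bool) → sum₂ f ≡ sum₂ (λ i → half i ∧ (f i xor f (p i)))
  sum₂-pair f = begin
    sum₂ f
      ≡⟨ sum₂-cong split ⟩
    sum₂ (λ i → (half i ∧ f i) xor (half (p i) ∧ f i))
      ≡⟨ sum₂-xor (λ i → half i ∧ f i) (λ i → half (p i) ∧ f i) ⟩
    sum₂ (λ i → half i ∧ f i) xor sum₂ (λ i → half (p i) ∧ f i)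
      ≡⟨ cong (sum₂ (λ i → half i ∧ f i) xor_) reindex ⟩
    sum₂ (λ i → half i ∧ f i) xor sum₂ (λ i → half i ∧ f (p i))
      ≡⟨ sum₂-xor (λ i → half i ∧ f i) (λ i → half i ∧ f (p i)) ⟨
    sum₂ (λ i → (half i ∧ f i) xor (half i ∧ f (p i)))
      ≡⟨ sum₂-cong (λ i → ∧-distribˡ-xor (half i) (f i) (f (p i))) ⟨
    sum₂ (λ i → half i ∧ (f i xor f (p i))) ∎
    where
    open ≡-Reasoning
    split : ∀ i → f i ≡ (half i ∧ f i) xor (half (p i) ∧ f i)
    split i = sym (trans (sym (∧-distribʳ-xor (f i) (half i) (half (p i))))
                         (cong (_∧ f i) (half-xor i)))
    reindex : sum₂ (λ i → half (p i) ∧ f i) ≡ sum₂ (λ i → half i ∧ f (p i))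
    reindex = trans (sum₂-cong (λ i → cong (λ j → half (p i) ∧ f j) (sym (p-invol i))))
                    (sum₂-permute (λ i → half i ∧ f (p i)) p-permutation)

  sum₂-half-onEdge : ∀ (f : Fin n → Bool) → (∀ a → f (p a) ≡ f a) →
                     ∀ w → sum₂ (λ i → (half i ∧ f i) ∧ onEdge i w) ≡ f w
  sum₂-half-onEdge f f-invariant w = begin
    sum₂ (λ i → (half i ∧ f i) ∧ onEdge i w)
      ≡⟨ sum₂-∧-onEdge (λ i → half i ∧ f i) w ⟩
    (half w ∧ f w) xor (half (p w) ∧ f (p w))
      ≡⟨ cong (λ b → (half w ∧ f w) xor (half (p w) ∧ b)) (f-invariant w) ⟩
    (half w ∧ f w) xor (half (p w) ∧ f w)
      ≡⟨ ∧-distribʳ-xor (f w) (half w) (half (p w)) ⟨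
    (half w xor half (p w)) ∧ f w
      ≡⟨ cong (_∧ f w) (half-xor w) ⟩
    f w ∎
    where open ≡-Reasoning

  count-half : count half + count half ≡ n
  count-half = begin
    count half + count half
      ≡⟨ cong (count half +_) (ℕSum.sum-permute (indicator half) p-permutation) ⟩
    count half + ℕSum.sum (indicator (half ∘ p))
      ≡⟨ ℕSum.∑-distrib-+ (indicator half) (indicator (half ∘ p)) ⟨
    ℕSum.sum (λ i → indicator half i + indicator (half ∘ p) i)
      ≡⟨ ℕSum.sum-cong-≗ (λ i → one-of-two (half i) (half (p i)) (half-xor i)) ⟩
    count {n} (λ _ → true)
      ≡⟨ count-const-true n ⟩
    n ∎
    where
    open ≡-Reasoning
    one-of-two : ∀ x y → x xor y ≡ true → (if x then 1 else 0) + (if y then 1 else 0) ≡ 1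
    one-of-two false true  _ = refl
    one-of-two true  false _ = refl

  n/2≡count-half : n / 2 ≡ count half
  n/2≡count-half = begin
    n / 2                         ≡⟨ cong (_/ 2) count-half ⟨
    (count half + count half) / 2 ≡⟨ cong (_/ 2) double ⟩
    count half * 2 / 2            ≡⟨ m*n/n≡m (count half) 2 ⟩
    count half                    ∎
    where
    open ≡-Reasoning
    double : count half + count half ≡ count half * 2
    double = trans (cong (count half +_) (sym (ℕ.+-identityʳ _))) (ℕ.*-comm 2 (count half))

module TwinMatching {n} (G : Graph n) (M : PerfectMatching G)
                        (twins : ∀ u → AdjTwins G u (partner M u)) where

  p : Fin n → Fin n
  p = partner M

  open Pairing p (invol M) (noFix M)

  closedN≡xor : ∀ u w → closedN G u w ≡ δ w u xor adj G u w
  closedN≡xor u w with w ≟ u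
  ... | yes refl = sym (cong not (irrefl G u))
  ... | no _     = refl

  twin-row : ∀ u w → adj G u w xor adj G (p u) w ≡ onEdge u w
  twin-row u w = sym (xor≡false⇒≡ (begin
    (δ w u xor δ w (p u)) xor (adj G u w xor adj G (p u) w)
      ≡⟨ interchange (δ w u) (δ w (p u)) (adj G u w) (adj G (p u) w) ⟩
    (δ w u xor adj G u w) xor (δ w (p u) xor adj G (p u) w)
      ≡⟨ cong₂ _xor_ (sym (closedN≡xor u w)) (sym (closedN≡xor (p u) w)) ⟩
    closedN G u w xor closedN G (p u) w
      ≡⟨ cong (_xor closedN G (p u) w) (twins u w) ⟩
    closedN G (p u) w xor closedN G (p u) w
      ≡⟨ xor-same (closedN G (p u) w) ⟩
    false ∎))
    where open ≡-Reasoning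

  combination : (Fin n → Bool) → Fin n → Bool
  combination c w = sum₂ (λ i → c i ∧ adj G i w)

  combination-xor-partner : ∀ c w → combination c w xor combination c (p w) ≡ c w xor c (p w)
  combination-xor-partner c w = begin
    combination c w xor combination c (p w)
      ≡⟨ sum₂-xor (λ i → c i ∧ adj G i w) (λ i → c i ∧ adj G i (p w)) ⟨
    sum₂ (λ i → (c i ∧ adj G i w) xor (c i ∧ adj G i (p w)))
      ≡⟨ sum₂-cong (λ i → trans (sym (∧-distribˡ-xor (c i) _ _)) (cong (c i ∧_) (column i))) ⟩
    sum₂ (λ i → c i ∧ onEdge i w)
      ≡⟨ sum₂-∧-onEdge c w ⟩
    c w xor c (p w) ∎
    where
    open ≡-Reasoning
    column : ∀ i → adj G i w xor adj G i (p w) ≡ onEdge i w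
    column i rewrite adj-sym G i w | adj-sym G i (p w) = trans (twin-row w i) (onEdge-sym w i)

  combination-invariant : ∀ c → (∀ i → c (p i) ≡ c i) → ∀ w → combination c w ≡ c w
  combination-invariant c c-invariant w = begin
    combination c w
      ≡⟨ sum₂-pair (λ i → c i ∧ adj G i w) ⟩
    sum₂ (λ i → half i ∧ ((c i ∧ adj G i w) xor (c (p i) ∧ adj G (p i) w)))
      ≡⟨ sum₂-cong pointwise ⟩
    sum₂ (λ i → (half i ∧ c i) ∧ onEdge i w)
      ≡⟨ sum₂-half-onEdge c c-invariant w ⟩
    c w ∎
    where
    open ≡-Reasoning
    pointwise : ∀ i → half i ∧ ((c i ∧ adj G i w) xor (c (p i) ∧ adj G (p i) w))
                    ≡ (half i ∧ c i) ∧ onEdge i w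
    pointwise i rewrite c-invariant i =
      trans (cong (half i ∧_) (trans (sym (∧-distribˡ-xor (c i) _ _)) (cong (c i ∧_) (twin-row i w))))
            (sym (∧-assoc (half i) (c i) (onEdge i w)))

  adj-LinIndep : LinIndep (adj G)
  adj-LinIndep c c-vanishes w = trans (sym (combination-invariant c c-invariant w)) (c-vanishes w)
    where
    c-invariant : ∀ i → c (p i) ≡ c i
    c-invariant i = sym (xor≡false⇒≡ (begin
      c i xor c (p i)
        ≡⟨ combination-xor-partner c i ⟨
      combination c i xor combination c (p i)
        ≡⟨ cong₂ _xor_ (c-vanishes i) (c-vanishes (p i)) ⟩
      false ∎))
      where open ≡-Reasoning

  key : Fin n → ℕ
  key u = toℕ u ⊓ toℕ (p u)

  key-partner : ∀ u → key (p u) ≡ key u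
  key-partner u rewrite invol M u = ℕ.⊓-comm (toℕ (p u)) (toℕ u)

  key-≢ : ∀ {u v} → v ≢ u → v ≢ p u → key u ≢ key v
  key-≢ {u} {v} v≢u v≢pu ku≡kv =
    cases (ℕ.⊓-sel (toℕ u) (toℕ (p u))) (ℕ.⊓-sel (toℕ v) (toℕ (p v)))
    where
    from-keys : ∀ {a b} → key u ≡ toℕ a → key v ≡ toℕ b → b ≡ a
    from-keys ka kb = toℕ-injective (trans (sym kb) (trans (sym ku≡kv) ka))

    cases : key u ≡ toℕ u ⊎ key u ≡ toℕ (p u) → key v ≡ toℕ v ⊎ key v ≡ toℕ (p v) → ⊥
    cases (inj₁ ku) (inj₁ kv) = v≢u (from-keys ku kv)
    cases (inj₁ ku) (inj₂ kv) = v≢pu (trans (sym (invol M v)) (cong p (from-keys ku kv)))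
    cases (inj₂ ku) (inj₁ kv) = v≢pu (from-keys ku kv)
    cases (inj₂ ku) (inj₂ kv) =
      v≢u (trans (sym (invol M v)) (trans (cong p (from-keys ku kv)) (invol M u)))

  before : Fin n → Fin n → Bool
  before u v = ⌊ key u <? key v ⌋

  -- the half w term cancels the pairs split by halfBiclique
  farSide : Fin n → Fin n → Bool
  farSide a w = not (onEdge a w) ∧ ((before a w ∧ adj G a w) xor half w)

  farSide-on : ∀ a w → onEdge a w ≡ true → farSide a w ≡ false
  farSide-on a w = cong (λ b → not b ∧ ((before a w ∧ adj G a w) xor half w))

  farSide-off : ∀ a w → onEdge a w ≡ false → farSide a w ≡ (before a w ∧ adj G a w) xor half w
  farSide-off a w = cong (λ b → not b ∧ ((before a w ∧ adj G a w) xor half w))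

  farSide-partner : ∀ a w → farSide (p a) w ≡ farSide a w
  farSide-partner a w rewrite onEdge-partner a w | key-partner a with onEdge a w in on-edge
  ... | true  = refl
  ... | false = cong (λ b → (before a w ∧ b) xor half w)
                     (sym (xor≡false⇒≡ (trans (twin-row a w) on-edge)))

  halfBiclique : Biclique n
  halfBiclique = record { X = half ; Y = not ∘ half ; disjoint = ∧-inverseʳ ∘ half }

  edgeBiclique : Fin n → Biclique n
  edgeBiclique a = record
    { X = onEdge a ; Y = farSide a ; disjoint = λ w → ∧-not-∧-zero (onEdge a w) _ }

  oddCover : List (Biclique n)
  oddCover = halfBiclique ∷ select half edgeBiclique

  parity-edgeBicliques : ∀ u v → sum₂ (λ a → half a ∧ bicEdge (edgeBiclique a) u v)
                                 ≡ farSide u v xor farSide v u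
  parity-edgeBicliques u v = begin
    sum₂ (λ a → half a ∧ bicEdge (edgeBiclique a) u v)
      ≡⟨ sum₂-cong (λ a → trans (cong (half a ∧_) (bicEdge≡xor (edgeBiclique a) u v))
                                (∧-distribˡ-xor (half a) _ _)) ⟩
    sum₂ (λ a → (half a ∧ (onEdge a u ∧ farSide a v)) xor (half a ∧ (onEdge a v ∧ farSide a u)))
      ≡⟨ sum₂-xor (λ a → half a ∧ (onEdge a u ∧ farSide a v))
                  (λ a → half a ∧ (onEdge a v ∧ farSide a u)) ⟩
    sum₂ (λ a → half a ∧ (onEdge a u ∧ farSide a v)) xor
    sum₂ (λ a → half a ∧ (onEdge a v ∧ farSide a u))
      ≡⟨ cong₂ _xor_ (one-side u v) (one-side v u) ⟩
    farSide u v xor farSide v u ∎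
    where
    open ≡-Reasoning
    one-side : ∀ u v → sum₂ (λ a → half a ∧ (onEdge a u ∧ farSide a v)) ≡ farSide u v
    one-side u v = trans
      (sum₂-cong λ a → trans (cong (half a ∧_) (∧-comm (onEdge a u) _)) (sym (∧-assoc (half a) _ _)))
      (sum₂-half-onEdge (λ a → farSide a v) (λ a → farSide-partner a v) u)

  parity-oddCover : ∀ u v → parity oddCover u v ≡ (half u xor half v) xor (farSide u v xor farSide v u)
  parity-oddCover u v = cong₂ _xor_
    (trans (bicEdge≡xor halfBiclique u v) (∧-not-xor (half u) (half v)))
    (trans (parity-select half edgeBiclique u v) (parity-edgeBicliques u v))

  parity-matchingEdge : ∀ u → parity oddCover u (p u) ≡ adj G u (p u)
  parity-matchingEdge u = begin
    parity oddCover u (p u)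
      ≡⟨ parity-oddCover u (p u) ⟩
    (half u xor half (p u)) xor (farSide u (p u) xor farSide (p u) u)
      ≡⟨ cong₂ _xor_ (half-xor u) (cong₂ _xor_ far-u far-pu) ⟩
    true
      ≡⟨ isEdge M u ⟨
    adj G u (p u) ∎
    where
    open ≡-Reasoning
    far-u : farSide u (p u) ≡ false
    far-u = farSide-on u (p u) (onEdge-partnerʳ u)
    far-pu : farSide (p u) u ≡ false
    far-pu = farSide-on (p u) u (trans (onEdge-partner u u) (onEdge-self u))

  parity-crossEdge : ∀ {u v} → v ≢ u → v ≢ p u → parity oddCover u v ≡ adj G u v
  parity-crossEdge {u} {v} v≢u v≢pu = begin
    parity oddCover u v
      ≡⟨ parity-oddCover u v ⟩
    (half u xor half v) xor (farSide u v xor farSide v u)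
      ≡⟨ cong ((half u xor half v) xor_) (cong₂ _xor_ far-uv far-vu) ⟩
    (half u xor half v) xor (((before u v ∧ a) xor half v) xor ((before v u ∧ a) xor half u))
      ≡⟨ xor-orientation (half u) (half v) a (before u v) (before v u)
                         (<?-xor-swap (key-≢ v≢u v≢pu)) ⟩
    a ∎
    where
    open ≡-Reasoning
    a : Bool
    a = adj G u v
    u≢pv : u ≢ p v
    u≢pv u≡pv = v≢pu (trans (sym (invol M v)) (cong p (sym u≡pv)))
    far-uv : farSide u v ≡ (before u v ∧ a) xor half v
    far-uv = farSide-off u v (onEdge-off v≢u v≢pu)
    far-vu : farSide v u ≡ (before v u ∧ a) xor half u
    far-vu = trans (farSide-off v u (onEdge-off (v≢u ∘ sym) u≢pv))
                   (cong (λ b → (before v u ∧ b) xor half u) (adj-sym G v u))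

  oddCover-isOddCover : IsOddCover G oddCover
  oddCover-isOddCover u v u≢v with v ≟ p u
  ... | yes refl = parity-matchingEdge u
  ... | no v≢pu  = parity-crossEdge (u≢v ∘ sym) v≢pu

  length-oddCover : length oddCover ≤ n / 2 + 1
  length-oddCover = ℕ.≤-reflexive (begin
    suc (length (select half edgeBiclique)) ≡⟨ cong suc (length-select half edgeBiclique) ⟩
    suc (count half)                        ≡⟨ ℕ.+-comm 1 (count half) ⟩
    count half + 1                          ≡⟨ cong (_+ 1) n/2≡count-half ⟨
    n / 2 + 1                               ∎)
    where open ≡-Reasoning

lemma6p3 : (n : ℕ) (G : Graph n) (M : PerfectMatching G) →
           (∀ u → AdjTwins G u (partner M u)) →
           r₂≡ G n × b₂≤ G (n / 2 + 1)
lemma6p3 n G M twins =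
  LinIndep⇒IsRank₂ (adj G) adj-LinIndep , (oddCover , oddCover-isOddCover , length-oddCover)
  where open TwinMatching G M twins
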